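{- Let $n\ge 2$ and let $P_n$ be the path with vertices $v_1,v_2,\dots,v_n$ in order. Let $H$ be a $0_2$-invoking subset of $V(P_n)$ with $\emptyset\neq H\neq V(P_n)$. Then $v_n\in H$ if and only if $v_{n-1}\notin H$.
   Context: Diffusion on a finite simple graph $G$: a configuration assigns an integer stack size $|v|$ to each vertex; firing a configuration $C$ changes each $v$ simultaneously from $|v|^C$ to $|v|^C + |\{u\in N(v): |u|^C>|v|^C\}| - |\{u\in N(v): |u|^C<|v|^C\}|$. The 0-configuration has all stack sizes $0$. A perturbation of $H\subseteq V(G)$ from the 0-configuration is the step in which every vertex of $H$ sends one chip to each of its neighbours. $H$ is $0_2$-invoking if this perturbation followed by one ordinary firing yields the 0-configuration. -}

module Defs where

open import Data.Nat using (ℕ; suc)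
import Data.Nat as ℕ
open import Data.Nat.Properties using (1+n≢n)
open import Data.Fin using (Fin; toℕ)
open import Data.Bool using (Bool; true; false; if_then_else_; _∨_)
open import Data.Bool.Properties using (∨-comm)
open import Data.Integer using (ℤ; +_; _+_; _-_; -_; _<?_)
open import Data.List using (map; foldr; allFin)
open import Relation.Nullary.Decidable using (does; dec-false)
open import Relation.Binary.PropositionalEquality using (_≡_; refl) renaming (sym to ≡-sym)

record Graph : Set where
  field
    order : ℕ
    adj   : Fin order → Fin order → Bool
    sym   : ∀ u v → adj u v ≡ adj v u
    irr   : ∀ v → adj v v ≡ false

open Graph public

-- configurations: integer stack sizes on the vertices
Config : Graph → Set
Config G = Fin (order G) → ℤ

VSubset : Graph → Set
VSubset G = Fin (order G) → Bool

zeroConfig : (G : Graph) → Config G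
zeroConfig G _ = + 0

sumV : (G : Graph) → (Fin (order G) → ℤ) → ℤ
sumV G f = foldr _+_ (+ 0) (map f (allFin (order G)))

flow : ℤ → ℤ → ℤ
flow cu cv = if does (cv <? cu) then + 1 else (if does (cu <? cv) then - (+ 1) else + 0)

fire : (G : Graph) → Config G → Config G
fire G C v = C v + sumV G (λ u → if adj G u v then flow (C u) (C v) else + 0)

-- perturbation of H from configuration C: every vertex of H sends one
-- chip to each of its neighbours
perturb : (G : Graph) → VSubset G → Config G → Config G
perturb G H C v =
  C v + sumV G (λ u → if adj G u v then
                         ((if H u then + 1 else + 0) - (if H v then + 1 else + 0))
                       else + 0)

Invoking0₂ : (G : Graph) → VSubset G → Set
Invoking0₂ G H = ∀ v → fire G (perturb G H (zeroConfig G)) v ≡ + 0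

-- the path P_n on vertices Fin n (vertex v_{i+1} is index i); i ~ j iff |i-j| = 1
pathAdj : (n : ℕ) → Fin n → Fin n → Bool
pathAdj n i j = does (suc (toℕ i) ℕ.≟ toℕ j) ∨ does (suc (toℕ j) ℕ.≟ toℕ i)

pathAdj-sym : (n : ℕ) → ∀ i j → pathAdj n i j ≡ pathAdj n j i
pathAdj-sym n i j = ∨-comm (does (suc (toℕ i) ℕ.≟ toℕ j)) (does (suc (toℕ j) ℕ.≟ toℕ i))

pathAdj-irr : (n : ℕ) → ∀ i → pathAdj n i i ≡ false
pathAdj-irr n i rewrite dec-false (suc (toℕ i) ℕ.≟ toℕ i) 1+n≢n = refl

Path : ℕ → Graph
Path n = record { order = n ; adj = pathAdj n ; sym = pathAdj-sym n ; irr = pathAdj-irr n }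

{-# OPTIONS --safe #-}
module Submission where

-- After perturbing H, vertex v holds the sum of H(u) − H(v) over its neighbours u. On a
-- path, constancy of H propagates backwards: if H = b from vertex k+1 to the end, the
-- perturbed configuration vanishes from k+2 on, so the firing at k+2 sees only its lower
-- neighbour k+1 and returns to 0 only if that stack is 0 too; but that stack is H(k) − b.
-- Hence if the last two vertices agree, H is constant, contradicting ∅ ≠ H ≠ V.

open import Defs hiding (sym)
open import Data.Bool using (Bool; true; false; not; _∨_; if_then_else_)
open import Data.Bool.Properties using (¬-not)
open import Data.Fin using (Fin; zero; suc; toℕ; fromℕ; fromℕ<; inject₁)
open import Data.Fin.Properties using (toℕ-injective; toℕ<n; toℕ-fromℕ<; toℕ-fromℕ; toℕ-inject₁; suc-injective)
open import Data.Integer using (ℤ; +_; -[1+_]; _+_; _-_)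
import Data.Integer.Properties as ℤ
open import Data.List using (foldr; tabulate)
open import Data.List.Properties using (map-tabulate)
open import Data.Nat using (ℕ; zero; suc; _≤_; _<_; s≤s)
import Data.Nat as ℕ
import Data.Nat.Properties as ℕ
open import Data.Product using (∃; _,_)
open import Data.Sum using (_⊎_; inj₁; inj₂)
open import Function using (_∘_; id)
open import Function.Bundles using (_⇔_; mk⇔)
open import Relation.Nullary using (Dec; does; yes; no; contradiction)
open import Relation.Nullary.Decidable using (dec-true)
open import Relation.Binary.PropositionalEquality
  using (_≡_; _≢_; refl; sym; trans; cong; cong₂; subst; module ≡-Reasoning)

-- Unlike map f (allFin n), tabulate f unfolds to f zero ∷ tabulate (f ∘ suc).
∑ : ∀ {n} → (Fin n → ℤ) → ℤ
∑ f = foldr _+_ (+ 0) (tabulate f)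

sumV≡∑ : (G : Graph) (f : Fin (order G) → ℤ) → sumV G f ≡ ∑ f
sumV≡∑ G f = cong (foldr _+_ (+ 0)) (map-tabulate id f)

∑-zero : ∀ {n} (f : Fin n → ℤ) → (∀ u → f u ≡ + 0) → ∑ f ≡ + 0
∑-zero {zero}  f f≡0 = refl
∑-zero {suc n} f f≡0 = cong₂ _+_ (f≡0 zero) (∑-zero (f ∘ suc) (f≡0 ∘ suc))

∑-single : ∀ {n} (f : Fin n → ℤ) (a : Fin n) → (∀ u → u ≢ a → f u ≡ + 0) → ∑ f ≡ f a
∑-single f zero f≡0 = begin
  f zero + ∑ (f ∘ suc) ≡⟨ cong (_+_ (f zero)) (∑-zero (f ∘ suc) (λ u → f≡0 (suc u) λ ())) ⟩
  f zero + + 0         ≡⟨ ℤ.+-identityʳ (f zero) ⟩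
  f zero               ∎
  where open ≡-Reasoning
∑-single f (suc a) f≡0 = begin
  f zero + ∑ (f ∘ suc) ≡⟨ cong (_+ ∑ (f ∘ suc)) (f≡0 zero λ ()) ⟩
  + 0 + ∑ (f ∘ suc)    ≡⟨ ℤ.+-identityˡ _ ⟩
  ∑ (f ∘ suc)          ≡⟨ ∑-single (f ∘ suc) a (λ u u≢a → f≡0 (suc u) (u≢a ∘ suc-injective)) ⟩
  f (suc a)            ∎
  where open ≡-Reasoning

module _ (G : Graph) where

  private
    V : Set
    V = Fin (order G)

  neighbourSum : V → (V → ℤ) → ℤ
  neighbourSum v f = sumV G (λ u → if adj G u v then f u else + 0)

  neighbourSum-zero : ∀ v (f : V → ℤ) → (∀ u → adj G u v ≡ true → f u ≡ + 0) →
                      neighbourSum v f ≡ + 0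
  neighbourSum-zero v f f≡0 = trans (sumV≡∑ G _) (∑-zero _ vanish)
    where
    vanish : ∀ u → (if adj G u v then f u else + 0) ≡ + 0
    vanish u with adj G u v in u~v
    ... | true  = f≡0 u u~v
    ... | false = refl

  neighbourSum-single : ∀ v (f : V → ℤ) a → adj G a v ≡ true →
                        (∀ u → u ≢ a → adj G u v ≡ true → f u ≡ + 0) →
                        neighbourSum v f ≡ f a
  neighbourSum-single v f a a~v f≡0 = begin
    neighbourSum v f                        ≡⟨ sumV≡∑ G _ ⟩
    ∑ (λ u → if adj G u v then f u else + 0) ≡⟨ ∑-single _ a vanish ⟩
    (if adj G a v then f a else + 0)         ≡⟨ cong (if_then f a else + 0) a~v ⟩
    f a                                      ∎
    where
    open ≡-Reasoning
    vanish : ∀ u → u ≢ a → (if adj G u v then f u else + 0) ≡ + 0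
    vanish u u≢a with adj G u v in u~v
    ... | true  = f≡0 u u≢a u~v
    ... | false = refl

indicator : Bool → ℤ
indicator b = if b then + 1 else + 0

indicator-cancel : ∀ x → indicator x - indicator x ≡ + 0
indicator-cancel false = refl
indicator-cancel true  = refl

indicator-injective : ∀ x y → + 0 + (indicator x - indicator y) ≡ + 0 → x ≡ y
indicator-injective false false _ = refl
indicator-injective true  true  _ = refl

flow-from-zero : ∀ x → + 0 + flow x (+ 0) ≡ + 0 → x ≡ + 0
flow-from-zero (+ zero)  _ = refl
flow-from-zero (+ suc _) ()
flow-from-zero -[1+ _ ]  ()

module _ (G : Graph) (H : VSubset G) where

  private
    C : Config G
    C = perturb G H (zeroConfig G)

  perturb-locallyConstant : ∀ v → (∀ u → adj G u v ≡ true → H u ≡ H v) → C v ≡ + 0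
  perturb-locallyConstant v H≡ = cong (_+_ (+ 0)) (neighbourSum-zero G v _ cancel)
    where
    cancel : ∀ u → adj G u v ≡ true → indicator (H u) - indicator (H v) ≡ + 0
    cancel u u~v rewrite H≡ u u~v = indicator-cancel (H v)

  perturb-single : ∀ v a → adj G a v ≡ true → (∀ u → u ≢ a → adj G u v ≡ true → H u ≡ H v) →
                   C v ≡ + 0 → H a ≡ H v
  perturb-single v a a~v H≡ Cv≡0 = indicator-injective (H a) (H v) (begin
    + 0 + (indicator (H a) - indicator (H v)) ≡⟨ cong (_+_ (+ 0)) (sym (neighbourSum-single G v _ a a~v cancel)) ⟩
    C v                                       ≡⟨ Cv≡0 ⟩
    + 0                                       ∎)
    where
    open ≡-Reasoning
    cancel : ∀ u → u ≢ a → adj G u v ≡ true → indicator (H u) - indicator (H v) ≡ + 0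
    cancel u u≢a u~v rewrite H≡ u u≢a u~v = indicator-cancel (H v)

fire-single : (G : Graph) (C : Config G) → ∀ v a → fire G C v ≡ + 0 → C v ≡ + 0 →
              adj G a v ≡ true → (∀ u → u ≢ a → adj G u v ≡ true → C u ≡ + 0) → C a ≡ + 0
fire-single G C v a fire≡0 Cv≡0 a~v C≡0 = flow-from-zero (C a) (begin
  + 0 + flow (C a) (+ 0)                        ≡⟨ cong₂ (λ x y → x + flow (C a) y) (sym Cv≡0) (sym Cv≡0) ⟩
  C v + flow (C a) (C v)                        ≡⟨ cong (_+_ (C v)) (sym (neighbourSum-single G v _ a a~v still)) ⟩
  C v + neighbourSum G v (λ u → flow (C u) (C v)) ≡⟨ fire≡0 ⟩
  + 0                                           ∎)
  where
  open ≡-Reasoning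
  still : ∀ u → u ≢ a → adj G u v ≡ true → flow (C u) (C v) ≡ + 0
  still u u≢a u~v rewrite C≡0 u u≢a u~v | Cv≡0 = refl

does-∨-witness : ∀ {a b} {A : Set a} {B : Set b} (A? : Dec A) (B? : Dec B) →
                 does A? ∨ does B? ≡ true → A ⊎ B
does-∨-witness (yes x) _       _ = inj₁ x
does-∨-witness (no _)  (yes y) _ = inj₂ y
does-∨-witness (no _)  (no _)  ()

module _ {n : ℕ} {u v : Fin n} where

  pathAdj-intro : suc (toℕ u) ≡ toℕ v → pathAdj n u v ≡ true
  pathAdj-intro e rewrite dec-true (suc (toℕ u) ℕ.≟ toℕ v) e = refl

  pathAdj-elim : pathAdj n u v ≡ true → suc (toℕ u) ≡ toℕ v ⊎ suc (toℕ v) ≡ toℕ u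
  pathAdj-elim = does-∨-witness (suc (toℕ u) ℕ.≟ toℕ v) (suc (toℕ v) ℕ.≟ toℕ u)

  pathAdj-other : ∀ {a} → pathAdj n u v ≡ true → suc (toℕ a) ≡ toℕ v → u ≢ a →
                  toℕ u ≡ suc (toℕ v)
  pathAdj-other u~v a→v u≢a with pathAdj-elim u~v
  ... | inj₁ u→v = contradiction (toℕ-injective (ℕ.suc-injective (trans u→v (sym a→v)))) u≢a
  ... | inj₂ v→u = sym v→u

  pathAdj-≥ : ∀ {k} → pathAdj n u v ≡ true → suc k ≤ toℕ v → k ≤ toℕ u
  pathAdj-≥ u~v k<v with pathAdj-elim u~v
  ... | inj₁ u→v = ℕ.≤-pred (subst (suc _ ≤_) (sym u→v) k<v)
  ... | inj₂ v→u = subst (_ ≤_) v→u (ℕ.m≤n⇒m≤1+n (ℕ.<⇒≤ k<v))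

module _ (m : ℕ) (H : VSubset (Path (suc (suc m))))
         (invoking : Invoking0₂ (Path (suc (suc m))) H) where

  private
    n : ℕ
    n = suc (suc m)
    G : Graph
    G = Path n
    C : Config G
    C = perturb G H (zeroConfig G)

  ConstantFrom : Bool → ℕ → Set
  ConstantFrom b k = ∀ v → k ≤ toℕ v → H v ≡ b

  constantFrom-extend : ∀ {b k} → ConstantFrom b (suc k) → (∀ v → toℕ v ≡ k → H v ≡ b) →
                        ConstantFrom b k
  constantFrom-extend above at v k≤v with ℕ.m≤n⇒m<n∨m≡n k≤v
  ... | inj₁ k<v = above v k<v
  ... | inj₂ k≡v = at v (sym k≡v)

  perturb-vanishes-above : ∀ {b k} → ConstantFrom b k → ∀ v → suc k ≤ toℕ v → C v ≡ + 0
  perturb-vanishes-above const v k<v = perturb-locallyConstant G H v λ u u~v →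
    trans (const u (pathAdj-≥ u~v k<v)) (sym (const v (ℕ.<⇒≤ k<v)))

  constantFrom-step : ∀ {b k} → ConstantFrom b (suc k) → suc k ≤ m → ConstantFrom b k
  constantFrom-step {b} {k} const k<m = constantFrom-extend const λ v v≡k →
    trans (cong H (toℕ-injective (trans v≡k (sym (toℕ-fromℕ< p₀))))) H₀≡b
    where
    p₂ : suc (suc k) < n
    p₂ = s≤s (s≤s k<m)
    p₁ : suc k < n
    p₁ = ℕ.<-trans (ℕ.n<1+n _) p₂
    p₀ : k < n
    p₀ = ℕ.<-trans (ℕ.n<1+n _) p₁
    v₀ v₁ v₂ : Fin n
    v₀ = fromℕ< p₀
    v₁ = fromℕ< p₁
    v₂ = fromℕ< p₂
    v₀→v₁ : suc (toℕ v₀) ≡ toℕ v₁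
    v₀→v₁ = trans (cong suc (toℕ-fromℕ< p₀)) (sym (toℕ-fromℕ< p₁))
    v₁→v₂ : suc (toℕ v₁) ≡ toℕ v₂
    v₁→v₂ = trans (cong suc (toℕ-fromℕ< p₁)) (sym (toℕ-fromℕ< p₂))
    k+2≤v₂ : suc (suc k) ≤ toℕ v₂
    k+2≤v₂ = ℕ.≤-reflexive (sym (toℕ-fromℕ< p₂))
    C₁≡0 : C v₁ ≡ + 0
    C₁≡0 = fire-single G C v₂ v₁ (invoking v₂) (perturb-vanishes-above const v₂ k+2≤v₂)
             (pathAdj-intro v₁→v₂) λ u u≢v₁ u~v₂ →
             perturb-vanishes-above const u
               (subst (suc (suc k) ≤_) (sym (pathAdj-other u~v₂ v₁→v₂ u≢v₁)) (ℕ.m≤n⇒m≤1+n k+2≤v₂))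
    H₁≡b : H v₁ ≡ b
    H₁≡b = const v₁ (ℕ.≤-reflexive (sym (toℕ-fromℕ< p₁)))
    H₀≡b : H v₀ ≡ b
    H₀≡b = trans (perturb-single G H v₁ v₀ (pathAdj-intro v₀→v₁) upper C₁≡0) H₁≡b
      where
      upper : ∀ u → u ≢ v₀ → pathAdj n u v₁ ≡ true → H u ≡ H v₁
      upper u u≢v₀ u~v₁ = trans (const u (subst (suc k ≤_) (sym u≡v₂) (ℕ.<⇒≤ k+2≤v₂))) (sym H₁≡b)
        where
        u≡v₂ : toℕ u ≡ toℕ v₂
        u≡v₂ = trans (pathAdj-other u~v₁ v₀→v₁ u≢v₀) v₁→v₂

  constantFrom-descend : ∀ {b} d k → d ℕ.+ k ≤ m → ConstantFrom b (d ℕ.+ k) → ConstantFrom b k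
  constantFrom-descend zero    k _       const = const
  constantFrom-descend (suc d) k d+k<m const =
    constantFrom-descend d k (ℕ.<⇒≤ d+k<m) (constantFrom-step const d+k<m)

  constantFrom-lastTwo : ∀ {b} → H (fromℕ (suc m)) ≡ b → H (inject₁ (fromℕ m)) ≡ b →
                         ConstantFrom b m
  constantFrom-lastTwo {b} last≡b penultimate≡b =
    constantFrom-extend (constantFrom-extend beyond atLast) atPenultimate
    where
    beyond : ConstantFrom b n
    beyond v n≤v = contradiction (toℕ<n v) (ℕ.≤⇒≯ n≤v)
    atLast : ∀ v → toℕ v ≡ suc m → H v ≡ b
    atLast v v≡ = trans (cong H (toℕ-injective (trans v≡ (sym (toℕ-fromℕ (suc m)))))) last≡b
    atPenultimate : ∀ v → toℕ v ≡ m → H v ≡ b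
    atPenultimate v v≡ =
      trans (cong H (toℕ-injective (trans v≡ (sym (trans (toℕ-inject₁ (fromℕ m)) (toℕ-fromℕ m))))))
            penultimate≡b

  lastTwo-agree⇒constant : H (fromℕ (suc m)) ≡ H (inject₁ (fromℕ m)) →
                           ∀ v → H v ≡ H (fromℕ (suc m))
  lastTwo-agree⇒constant agree v = constantFrom-descend m 0 (ℕ.≤-reflexive m+0≡m)
    (subst (ConstantFrom _) (sym m+0≡m) (constantFrom-lastTwo refl (sym agree))) v ℕ.z≤n
    where
    m+0≡m : m ℕ.+ 0 ≡ m
    m+0≡m = ℕ.+-identityʳ m

  lastTwo-differ : (∃ λ v → H v ≡ true) → (∃ λ v → H v ≡ false) →
                   H (fromℕ (suc m)) ≢ H (inject₁ (fromℕ m))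
  lastTwo-differ (t , Ht≡true) (f , Hf≡false) agree = contradiction true≡false λ ()
    where
    true≡false : true ≡ false
    true≡false = trans (sym Ht≡true) (trans (lastTwo-agree⇒constant agree t)
                   (trans (sym (lastTwo-agree⇒constant agree f)) Hf≡false))

mainTheorem8 : (m : ℕ) (H : VSubset (Path (suc (suc m)))) →
    Invoking0₂ (Path (suc (suc m))) H →
    (∃ λ v → H v ≡ true) →
    (∃ λ v → H v ≡ false) →
    (H (fromℕ (suc m)) ≡ true) ⇔ (H (inject₁ (fromℕ m)) ≡ false)
mainTheorem8 m H invoking some none =
  mk⇔ (λ last≡true → trans (¬-not (differ ∘ sym)) (cong not last≡true))
      (λ penultimate≡false → trans (¬-not differ) (cong not penultimate≡false))
  where
  differ : H (fromℕ (suc m)) ≢ H (inject₁ (fromℕ m))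
  differ = lastTwo-differ m H invoking some none
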